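{- Let $k\ge 2$ be an integer, let $f(x)\in\mathbb{Z}[x]$ be a nonconstant polynomial and let $c$ be an integer. Then the function $n\mapsto \mathcal{N}_{k,f,c}(n)$ is multiplicative, and for every positive integer $n$, $$\mathcal{N}_{k,f,c}(n)=n^{k-1}\prod_{p\mid n}\Big(1-\frac{\mathcal{M}_{k,f,c}(p)}{p^{k-1}}\Big),$$ where the product runs over the distinct prime divisors $p$ of $n$.
   Context: For a positive integer $n$, $\mathbb{Z}_n=\{0,1,\dots,n-1\}$ denotes the ring of residue classes modulo $n$. For $f(x)\in\mathbb{Z}[x]$, an integer $a$ is called an $f$-exunit in $\mathbb{Z}_n$ if $\gcd(f(a),n)=1$, and $E_f(n)=\{a\in\mathbb{Z}_n:\gcd(f(a),n)=1\}$. Define $$\mathcal{N}_{k,f,c}(n)=\#\{(x_1,\dots,x_k)\in E_f(n)^k: x_1+\cdots+x_k\equiv c\pmod n\}.$$ For a prime $p$, define $$\mathcal{M}_{k,f,c}(p)=\#\Big\{(x_1,\dots,x_{k-1})\in\mathbb{Z}_p^{k-1}: f(x_1)\cdots f(x_{k-1})\,f\Big(c-\sum_{i=1}^{k-1}x_i\Big)\equiv 0\pmod p\Big\}.$$ -}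

module Defs where

open import Data.Bool using (Bool; true; false; if_then_else_)
open import Data.Nat as ℕ using (ℕ; zero; suc; _≤_)
open import Data.Nat.Properties using (m^n≢0)
open import Data.Nat.Divisibility using (_∣?_)
open import Data.Nat.Primality using (prime?)
open import Data.Nat.ListAction using (sum)
open import Data.Integer as ℤ using (ℤ; +_; 0ℤ; 1ℤ; ∣_∣)
open import Data.Integer.GCD using (gcd)
open import Data.Integer.Divisibility as ℤD using ()
open import Data.Rational as ℚ using (ℚ; 1ℚ)
open import Data.List as List using (List; []; _∷_; upTo; filter)
open import Data.Vec as Vec using (Vec; []; _∷_)
open import Data.Product using (∃-syntax; _×_)
open import Relation.Nullary using (¬_; Dec; yes; no)
open import Relation.Nullary.Decidable using (⌊_⌋; _×-dec_)
open import Relation.Binary.PropositionalEquality using (_≡_; _≢_)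

-- Polynomials in ℤ[x]: coefficient lists, lowest degree first
-- (a₀ ∷ a₁ ∷ … ∷ a_d ∷ [] represents a₀ + a₁ x + … + a_d x^d).
Poly : Set
Poly = List ℤ

coeff : Poly → ℕ → ℤ
coeff []       _       = 0ℤ
coeff (a ∷ f)  zero    = a
coeff (a ∷ f)  (suc i) = coeff f i

eval : Poly → ℤ → ℤ
eval []      x = 0ℤ
eval (a ∷ f) x = a ℤ.+ x ℤ.* eval f x

NonConstant : Poly → Set
NonConstant f = ∃[ i ] (1 ≤ i × coeff f i ≢ 0ℤ)

IsExunit : Poly → ℕ → ℤ → Set
IsExunit f n a = gcd (eval f a) (+ n) ≡ 1ℤ

isExunit? : ∀ f n a → Dec (IsExunit f n a)
isExunit? f n a = gcd (eval f a) (+ n) ℤ.≟ 1ℤ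

_∣ℤ?_ : (d x : ℤ) → Dec (d ℤD.∣ x)
d ∣ℤ? x = ∣ d ∣ ∣? ∣ x ∣

residues : ℕ → List ℤ
residues n = List.map +_ (upTo n)

countTuples : (n k : ℕ) → (Vec ℤ k → Bool) → ℕ
countTuples n zero    P = if P [] then 1 else 0
countTuples n (suc k) P =
  sum (List.map (λ a → countTuples n k (λ v → P (a ∷ v))) (residues n))

allB : ∀ {k} → (ℤ → Bool) → Vec ℤ k → Bool
allB p []       = true
allB p (x ∷ xs) = if p x then allB p xs else false

vsum : ∀ {k} → Vec ℤ k → ℤ
vsum = Vec.foldr _ ℤ._+_ 0ℤ

vprod : ∀ {k} → Vec ℤ k → ℤ
vprod = Vec.foldr _ ℤ._*_ 1ℤ

𝒩 : (k : ℕ) → Poly → ℤ → ℕ → ℕ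
𝒩 k f c n = countTuples n k λ xs →
  if allB (λ a → ⌊ isExunit? f n a ⌋) xs
  then ⌊ (+ n) ∣ℤ? (vsum xs ℤ.- c) ⌋
  else false

𝓜 : (k : ℕ) → Poly → ℤ → ℕ → ℕ
𝓜 k f c p = countTuples p (k ℕ.∸ 1) λ xs →
  ⌊ (+ p) ∣ℤ? (vprod (Vec.map (eval f) xs) ℤ.* eval f (c ℤ.- vsum xs)) ⌋

primeDivisors : ℕ → List ℕ
primeDivisors n = filter (λ p → prime? p ×-dec (p ∣? n)) (upTo (suc n))

-- the local factor 1 - 𝓜(p)/p^{k-1}; the p = 0 clause is never used
-- (0 is not prime) and only serves to provide p^{k-1} ≠ 0 for p = suc q.
localFactor : (k : ℕ) → Poly → ℤ → ℕ → ℚ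
localFactor k f c zero    = 1ℚ
localFactor k f c (suc q) =
  1ℚ ℚ.- ((+ 𝓜 k f c (suc q)) ℚ./ (suc q ℕ.^ (k ℕ.∸ 1)))
    {{m^n≢0 (suc q) (k ℕ.∸ 1)}}

productFormula : (k : ℕ) → Poly → ℤ → ℕ → ℚ
productFormula k f c n =
  (+ (n ℕ.^ (k ℕ.∸ 1)) ℚ./ 1) ℚ.*
  List.foldr ℚ._*_ 1ℚ (List.map (localFactor k f c) (primeDivisors n))

{-# OPTIONS --safe #-}
-- The first coordinate of a tuple counted by 𝒩(n) is forced to be c − (x₂ + ⋯ + x_k) mod n, so 𝒩(n)
-- is the sum over ℤ_n^{k−1} of the indicator that x₂, …, x_k and c − (x₂ + ⋯ + x_k) are f-exunits mod n.
-- This indicator is periodic mod n; since gcd(f(a), mn) = 1 iff gcd(f(a), m) = gcd(f(a), n) = 1, the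
-- indicator for mn is the product of those for m and n, and for d ∣ n the indicator for dn is the one
-- for n. A sum over ℤ_{mn} of an m-periodic times an n-periodic function factors when gcd(m, n) = 1
-- (Chinese remainder theorem), so 𝒩 is multiplicative and 𝒩(dn) = d^{k−1} 𝒩(n) for d ∣ n. At a prime p
-- the indicator is the complement of the one counted by 𝓜(p), hence 𝒩(p) = p^{k−1} − 𝓜(p). The product
-- formula obeys the same rules and agrees with 𝒩 at primes, and a prime factorisation of n finishes.
module Submission where

open import Defs
open import Algebra.Bundles using (CommutativeMonoid)
open import Data.Bool using (Bool; true; false; T; _∧_; _∨_; not; if_then_else_)
open import Data.Bool.Properties using (∧-zeroʳ)
open import Data.Integer as ℤ using (ℤ; +_; ∣_∣)
import Data.Integer.DivMod as ℤDivMod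
open import Data.Integer.Divisibility.Signed as ℤ∣ using (divides)
import Data.Integer.Properties as ℤP
import Data.Integer.Solver as ℤSolver
open import Data.List as List using (List; []; _∷_; _∷ʳ_; applyUpTo; upTo; filter)
open import Data.List.Properties using (filter-accept; filter-reject; upTo-∷ʳ)
open import Data.List.Relation.Unary.All using (All; []; _∷_)
open import Data.Nat as ℕ
  using (ℕ; zero; suc; _+_; _*_; _∸_; _^_; _≤_; _<_; _≤′_; ≤′-refl; ≤′-step; s≤s; z≤n; NonZero; >-nonZero; _≡ᵇ_)
open import Data.Nat.Coprimality as Coprime
  using (Coprime; coprime?; coprime-Bézout; coprime-divisor; coprime⇒gcd≡1; gcd≡1⇒coprime; 1-coprimeTo)
open import Data.Nat.Divisibility using (_∣_; _∣?_; >⇒∤; ∣-trans; ∣-refl; m∣m*n; n∣m*n; ∣1⇒≡1)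
open import Data.Nat.GCD using (module Bézout)
open import Data.Nat.ListAction using (sum; product)
open import Data.Nat.Primality
  using (Prime; prime?; prime⇒irreducible; prime⇒nonZero; ¬prime[0]; ¬prime[1]; euclidsLemma; productOfPrimes≢0)
open import Data.Nat.Primality.Factorisation using (PrimeFactorisation; factorise)
open import Data.Nat.Properties
open import Data.Product using (_×_; _,_)
open import Data.Rational as ℚ using (ℚ; 1ℚ; _/_; toℚᵘ)
import Data.Rational.Properties as ℚP
import Data.Rational.Solver as ℚSolver
import Data.Rational.Unnormalised as ℚᵘ
import Data.Rational.Unnormalised.Properties as ℚᵘP
open import Data.Sum using (_⊎_; inj₁; inj₂; [_,_]; [_,_]′)
open import Data.Unit using (tt)
open import Data.Vec as Vec using (Vec; []; _∷_)
open import Data.Vec.Relation.Binary.Pointwise.Inductive as Pointwise using (Pointwise; []; _∷_)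
open import Function using (_∘_)
open import Function.Bundles using (mk⇔)
open import Relation.Binary.PropositionalEquality
  using (_≡_; refl; sym; trans; cong; cong₂; subst; module ≡-Reasoning)
open import Relation.Nullary using (¬_; Dec; yes; no; contradiction)
open import Relation.Nullary.Decidable using (⌊_⌋; T?; ¬?; _×-dec_; _⊎-dec_; isYes≗does; does-⇔)
open ≡-Reasoning
open import Algebra.Properties.CommutativeSemigroup +-commutativeSemigroup
  using () renaming (interchange to ℕ-+-interchange)
open import Algebra.Properties.CommutativeSemigroup (CommutativeMonoid.commutativeSemigroup ℚP.*-1-commutativeMonoid)
  using () renaming (interchange to ℚ-*-interchange)

𝟙 : Bool → ℕ
𝟙 b = if b then 1 else 0

isYes-T : ∀ {P : Set} (p? : Dec P) b → (P → T b) → (T b → P) → ⌊ p? ⌋ ≡ b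
isYes-T p? b to from = trans (isYes≗does p?) (does-⇔ (mk⇔ to from) p? (T? b))

isYes-⇔ : ∀ {P Q : Set} (p? : Dec P) (q? : Dec Q) → (P → Q) → (Q → P) → ⌊ p? ⌋ ≡ ⌊ q? ⌋
isYes-⇔ p? q? to from =
  trans (isYes≗does p?) (trans (does-⇔ (mk⇔ to from) p? q?) (sym (isYes≗does q?)))

isYes-× : ∀ {P Q : Set} (p? : Dec P) (q? : Dec Q) → ⌊ p? ×-dec q? ⌋ ≡ ⌊ p? ⌋ ∧ ⌊ q? ⌋
isYes-× p? q? = trans (isYes≗does (p? ×-dec q?)) (sym (cong₂ _∧_ (isYes≗does p?) (isYes≗does q?)))

isYes-⊎ : ∀ {P Q : Set} (p? : Dec P) (q? : Dec Q) → ⌊ p? ⊎-dec q? ⌋ ≡ ⌊ p? ⌋ ∨ ⌊ q? ⌋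
isYes-⊎ p? q? = trans (isYes≗does (p? ⊎-dec q?)) (sym (cong₂ _∨_ (isYes≗does p?) (isYes≗does q?)))

isYes-¬ : ∀ {P : Set} (p? : Dec P) → ⌊ ¬? p? ⌋ ≡ not ⌊ p? ⌋
isYes-¬ p? = trans (isYes≗does (¬? p?)) (sym (cong not (isYes≗does p?)))

𝟙-∧ : ∀ x y → 𝟙 (x ∧ y) ≡ 𝟙 x * 𝟙 y
𝟙-∧ true  y = sym (+-identityʳ (𝟙 y))
𝟙-∧ false y = refl

𝟙-if-if : ∀ x y z → 𝟙 (if (if x then y else false) then z else false) ≡ 𝟙 y * (𝟙 x * 𝟙 z)
𝟙-if-if true  true  z = sym (trans (*-identityˡ _) (*-identityˡ (𝟙 z)))
𝟙-if-if true  false z = refl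
𝟙-if-if false true  z = refl
𝟙-if-if false false z = refl

module _ {p q : ℤ → Bool} where

  allB-cong : (∀ x → p x ≡ q x) → ∀ {j} (v : Vec ℤ j) → allB p v ≡ allB q v
  allB-cong eq []      = refl
  allB-cong eq (x ∷ v) rewrite eq x | allB-cong eq v = refl

  allB-∧ : ∀ {r} → (∀ x → p x ≡ q x ∧ r x) → ∀ {j} (v : Vec ℤ j) → allB p v ≡ allB q v ∧ allB r v
  allB-∧ eq []      = refl
  allB-∧ {r} eq (x ∷ v) rewrite eq x | allB-∧ eq v with q x | r x
  ... | true  | true  = refl
  ... | true  | false = sym (∧-zeroʳ (allB q v))
  ... | false | _     = refl

allB-true : ∀ {p : ℤ → Bool} → (∀ x → p x ≡ true) → ∀ {j} (v : Vec ℤ j) → allB p v ≡ true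
allB-true eq []      = refl
allB-true eq (x ∷ v) rewrite eq x = allB-true eq v

-- Sums over ranges

sumBelow : ℕ → (ℕ → ℕ) → ℕ
sumBelow zero    u = 0
sumBelow (suc n) u = u 0 + sumBelow n (u ∘ suc)

sumBelow-cong< : ∀ n {u w : ℕ → ℕ} → (∀ x → x < n → u x ≡ w x) → sumBelow n u ≡ sumBelow n w
sumBelow-cong< zero    eq = refl
sumBelow-cong< (suc n) eq =
  cong₂ _+_ (eq 0 (s≤s z≤n)) (sumBelow-cong< n (λ x x<n → eq (suc x) (s≤s x<n)))

sumBelow-cong : ∀ n {u w : ℕ → ℕ} → (∀ x → u x ≡ w x) → sumBelow n u ≡ sumBelow n w
sumBelow-cong n eq = sumBelow-cong< n (λ x _ → eq x)

sumBelow-split : ∀ a b u → sumBelow (a + b) u ≡ sumBelow a u + sumBelow b (λ x → u (a + x))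
sumBelow-split zero    b u = refl
sumBelow-split (suc a) b u =
  trans (cong (_+_ (u 0)) (sumBelow-split a b (u ∘ suc))) (sym (+-assoc (u 0) _ _))

sumBelow-+ : ∀ n u w → sumBelow n (λ x → u x + w x) ≡ sumBelow n u + sumBelow n w
sumBelow-+ zero    u w = refl
sumBelow-+ (suc n) u w =
  trans (cong (_+_ (u 0 + w 0)) (sumBelow-+ n (u ∘ suc) (w ∘ suc))) (ℕ-+-interchange (u 0) (w 0) _ _)

sumBelow-*ˡ : ∀ n c u → sumBelow n (λ x → c * u x) ≡ c * sumBelow n u
sumBelow-*ˡ zero    c u = sym (*-zeroʳ c)
sumBelow-*ˡ (suc n) c u =
  trans (cong (_+_ (c * u 0)) (sumBelow-*ˡ n c (u ∘ suc))) (sym (*-distribˡ-+ c (u 0) _))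

sumBelow-const : ∀ n c → sumBelow n (λ _ → c) ≡ n * c
sumBelow-const zero    c = refl
sumBelow-const (suc n) c = cong (_+_ c) (sumBelow-const n c)

sumBelow-zero : ∀ n → sumBelow n (λ _ → 0) ≡ 0
sumBelow-zero n = trans (sumBelow-const n 0) (*-zeroʳ n)

sumBelow-swap : ∀ m n (h : ℕ → ℕ → ℕ) →
  sumBelow m (λ a → sumBelow n (h a)) ≡ sumBelow n (λ b → sumBelow m (λ a → h a b))
sumBelow-swap zero    n h = sym (sumBelow-zero n)
sumBelow-swap (suc m) n h =
  trans (cong (_+_ (sumBelow n (h 0))) (sumBelow-swap m n (h ∘ suc)))
        (sym (sumBelow-+ n (h 0) (λ b → sumBelow m (λ a → h (suc a) b))))

sumBelow-blocks : ∀ t m w → sumBelow (t * m) w ≡ sumBelow t (λ i → sumBelow m (λ r → w (i * m + r)))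
sumBelow-blocks zero    m w = refl
sumBelow-blocks (suc t) m w = trans (sumBelow-split m (t * m) w) (cong (_+_ (sumBelow m w))
  (trans (sumBelow-blocks t m (λ x → w (m + x)))
         (sumBelow-cong t (λ i → sumBelow-cong m (λ r → cong w (sym (+-assoc m (i * m) r)))))))

sumBelow-rotate : ∀ n (w : ℕ → ℕ) → w n ≡ w 0 → sumBelow n (w ∘ suc) ≡ sumBelow n w
sumBelow-rotate n w wn≡w0 = +-cancelˡ-≡ (w 0) _ _ (begin
  sumBelow (1 + n) w           ≡⟨ cong (λ z → sumBelow z w) (+-comm 1 n) ⟩
  sumBelow (n + 1) w           ≡⟨ sumBelow-split n 1 w ⟩
  sumBelow n w + (w (n + 0) + 0) ≡⟨ cong (λ z → sumBelow n w + (w z + 0)) (+-identityʳ n) ⟩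
  sumBelow n w + (w n + 0)     ≡⟨ cong (λ z → sumBelow n w + z) (trans (+-identityʳ (w n)) wn≡w0) ⟩
  sumBelow n w + w 0           ≡⟨ +-comm (sumBelow n w) (w 0) ⟩
  w 0 + sumBelow n w           ∎)

sumBelow-indicator : ∀ n (h : ℕ → ℕ) {r} → r < n → sumBelow n (λ a → h a * 𝟙 (a ≡ᵇ r)) ≡ h r
sumBelow-indicator (suc n) h {zero}  _ = begin
  h 0 * 1 + sumBelow n (λ a → h (suc a) * 0) ≡⟨ cong₂ _+_ (*-identityʳ (h 0))
                                                   (trans (sumBelow-cong n (λ a → *-zeroʳ (h (suc a)))) (sumBelow-zero n)) ⟩
  h 0 + 0                                      ≡⟨ +-identityʳ (h 0) ⟩
  h 0                                          ∎
sumBelow-indicator (suc n) h {suc r} (s≤s r<n) =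
  cong₂ _+_ (*-zeroʳ (h 0)) (sumBelow-indicator n (h ∘ suc) r<n)

Periodic : ℕ → (ℕ → ℕ) → Set
Periodic n u = ∀ x → u (n + x) ≡ u x

periodic-* : ∀ {n u} → Periodic n u → ∀ t x → u (t * n + x) ≡ u x
periodic-* {n} {u} per zero    x = refl
periodic-* {n} {u} per (suc t) x = trans (cong u (+-assoc n (t * n) x)) (trans (per _) (periodic-* per t x))

sumBelow-periodic : ∀ m {n u} → Periodic n u → sumBelow (m * n) u ≡ m * sumBelow n u
sumBelow-periodic zero    per = refl
sumBelow-periodic (suc m) {n} {u} per = trans (sumBelow-split n (m * n) u)
  (cong (_+_ (sumBelow n u)) (trans (sumBelow-cong (m * n) per) (sumBelow-periodic m per)))

-- By Bézout, 1 = x m - y n or 1 = y n - x m, so a shift by 1 is a combination of the two periods.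
coprime-periods⇒constant : ∀ {m n} (u : ℕ → ℕ) → Coprime m n → Periodic m u → Periodic n u →
                           ∀ r → u r ≡ u 0
coprime-periods⇒constant {m} {n} u cop perm pern = constant
  where
  step : ∀ r → u (suc r) ≡ u r
  step r with coprime-Bézout cop
  ... | Bézout.+- x y 1+yn≡xm = begin
    u (suc r)         ≡⟨ periodic-* pern y (suc r) ⟨
    u (y * n + suc r) ≡⟨ cong u (trans (+-suc (y * n) r) (cong (_+ r) 1+yn≡xm)) ⟩
    u (x * m + r)     ≡⟨ periodic-* perm x r ⟩
    u r               ∎
  ... | Bézout.-+ x y 1+xm≡yn = begin
    u (suc r)         ≡⟨ periodic-* perm x (suc r) ⟨
    u (x * m + suc r) ≡⟨ cong u (trans (+-suc (x * m) r) (cong (_+ r) 1+xm≡yn)) ⟩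
    u (y * n + r)     ≡⟨ periodic-* pern y r ⟩
    u r               ∎
  constant : ∀ r → u r ≡ u 0
  constant zero    = refl
  constant (suc r) = trans (step r) (constant r)

sumBelow-coprime-* : ∀ m n (u v : ℕ → ℕ) → .{{NonZero m}} → Coprime m n → Periodic m u → Periodic n v →
                     sumBelow (m * n) (λ x → u x * v x) ≡ sumBelow m u * sumBelow n v
sumBelow-coprime-* m n u v cop peru perv = begin
  sumBelow (m * n) (λ x → u x * v x)
    ≡⟨ cong (λ z → sumBelow z (λ x → u x * v x)) (*-comm m n) ⟩
  sumBelow (n * m) (λ x → u x * v x)
    ≡⟨ sumBelow-blocks n m _ ⟩
  sumBelow n (λ t → sumBelow m (λ r → u (t * m + r) * v (t * m + r)))
    ≡⟨ sumBelow-cong n (λ t → sumBelow-cong m (λ r → cong (_* v (t * m + r)) (periodic-* peru t r))) ⟩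
  sumBelow n (λ t → sumBelow m (λ r → u r * v (t * m + r)))
    ≡⟨ sumBelow-swap n m _ ⟩
  sumBelow m (λ r → sumBelow n (λ t → u r * v (t * m + r)))
    ≡⟨ sumBelow-cong m (λ r → sumBelow-*ˡ n (u r) _) ⟩
  sumBelow m (λ r → u r * fibre r)
    ≡⟨ sumBelow-cong m (λ r → cong (u r *_) (trans (fibre-constant r) fibre0)) ⟩
  sumBelow m (λ r → u r * sumBelow n v)
    ≡⟨ sumBelow-cong m (λ r → *-comm (u r) (sumBelow n v)) ⟩
  sumBelow m (λ r → sumBelow n v * u r)
    ≡⟨ sumBelow-*ˡ m (sumBelow n v) u ⟩
  sumBelow n v * sumBelow m u
    ≡⟨ *-comm (sumBelow n v) (sumBelow m u) ⟩
  sumBelow m u * sumBelow n v ∎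
  where
  fibre : ℕ → ℕ
  fibre r = sumBelow n (λ t → v (t * m + r))
  fibre-periodⁿ : Periodic n fibre
  fibre-periodⁿ r = sumBelow-cong n (λ t → trans (cong v (begin
    t * m + (n + r) ≡⟨ +-assoc (t * m) n r ⟨
    t * m + n + r   ≡⟨ cong (_+ r) (+-comm (t * m) n) ⟩
    n + t * m + r   ≡⟨ +-assoc n (t * m) r ⟩
    n + (t * m + r) ∎)) (perv _))
  fibre-periodᵐ : Periodic m fibre
  fibre-periodᵐ r = trans
    (sumBelow-cong n (λ t → cong v (trans (sym (+-assoc (t * m) m r)) (cong (_+ r) (+-comm (t * m) m)))))
    (sumBelow-rotate n (λ t → v (t * m + r))
      (trans (cong (λ z → v (z + r)) (*-comm n m)) (periodic-* perv m r)))
  fibre-constant : ∀ r → fibre r ≡ fibre 0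
  fibre-constant = coprime-periods⇒constant fibre cop fibre-periodᵐ fibre-periodⁿ
  fibre0 : fibre 0 ≡ sumBelow n v
  fibre0 = *-cancelˡ-≡ (fibre 0) (sumBelow n v) m (begin
    m * fibre 0                                     ≡⟨ sumBelow-const m (fibre 0) ⟨
    sumBelow m (λ _ → fibre 0)                      ≡⟨ sumBelow-cong m (λ r → sym (fibre-constant r)) ⟩
    sumBelow m fibre                                ≡⟨ sumBelow-swap m n _ ⟩
    sumBelow n (λ t → sumBelow m (λ r → v (t * m + r))) ≡⟨ sumBelow-blocks n m v ⟨
    sumBelow (n * m) v                              ≡⟨ cong (λ z → sumBelow z v) (*-comm n m) ⟩
    sumBelow (m * n) v                              ≡⟨ sumBelow-periodic m perv ⟩
    m * sumBelow n v                                ∎)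

-- Congruences modulo n

-- a record rather than a synonym, so that x, y and n can be inferred from a proof
infix 4 _≡_mod_
record _≡_mod_ (x y : ℤ) (n : ℕ) : Set where
  constructor congruent
  field divides-difference : + n ℤ∣.∣ (x ℤ.- y)
open _≡_mod_

infix 4 _≋_mod_
_≋_mod_ : ∀ {j} → Vec ℤ j → Vec ℤ j → ℕ → Set
v ≋ w mod n = Pointwise (λ x y → x ≡ y mod n) v w

module _ {n : ℕ} where
  open ℤSolver.+-*-Solver

  private
    by : ∀ {d e} → d ≡ e → + n ℤ∣.∣ d → + n ℤ∣.∣ e
    by = subst (+ n ℤ∣.∣_)

  ≡mod-refl : ∀ x → x ≡ x mod n
  ≡mod-refl x = congruent (by (sym (ℤP.+-inverseʳ x)) (divides ℤ.0ℤ refl))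

  ≡mod-sym : ∀ {x y} → x ≡ y mod n → y ≡ x mod n
  ≡mod-sym {x} {y} (congruent x≡y) =
    congruent (by (solve 2 (λ x y → :- (x :- y) := y :- x) refl x y) (ℤ∣.∣m⇒∣-m x≡y))

  ≡mod-trans : ∀ {x y z} → x ≡ y mod n → y ≡ z mod n → x ≡ z mod n
  ≡mod-trans {x} {y} {z} (congruent x≡y) (congruent y≡z) =
    congruent (by (solve 3 (λ x y z → (x :- y) :+ (y :- z) := x :- z) refl x y z) (ℤ∣.∣m∣n⇒∣m+n x≡y y≡z))

  ≡mod-+ : ∀ {x y x′ y′} → x ≡ y mod n → x′ ≡ y′ mod n → x ℤ.+ x′ ≡ y ℤ.+ y′ mod n
  ≡mod-+ {x} {y} {x′} {y′} (congruent x≡y) (congruent x′≡y′) = congruent (by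
    (solve 4 (λ x y x′ y′ → (x :- y) :+ (x′ :- y′) := (x :+ x′) :- (y :+ y′)) refl x y x′ y′)
    (ℤ∣.∣m∣n⇒∣m+n x≡y x′≡y′))

  ≡mod-* : ∀ {x y x′ y′} → x ≡ y mod n → x′ ≡ y′ mod n → x ℤ.* x′ ≡ y ℤ.* y′ mod n
  ≡mod-* {x} {y} {x′} {y′} (congruent x≡y) (congruent x′≡y′) = congruent (by
    (solve 4 (λ x y x′ y′ → x :* (x′ :- y′) :+ (x :- y) :* y′ := x :* x′ :- y :* y′) refl x y x′ y′)
    (ℤ∣.∣m∣n⇒∣m+n (ℤ∣.∣n⇒∣m*n x x′≡y′) (ℤ∣.∣m⇒∣m*n y′ x≡y)))

  ≡mod-- : ∀ c {x y} → x ≡ y mod n → c ℤ.- x ≡ c ℤ.- y mod n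
  ≡mod-- c {x} {y} (congruent x≡y) = congruent (by
    (solve 3 (λ c x y → :- (x :- y) := (c :- x) :- (c :- y)) refl c x y) (ℤ∣.∣m⇒∣-m x≡y))

  n+x≡x-mod-n : ∀ x → + (n + x) ≡ + x mod n
  n+x≡x-mod-n x = congruent (by
    (trans (solve 2 (λ n x → n := (n :+ x) :- x) refl (+ n) (+ x)) (cong (ℤ._- + x) (sym (ℤP.pos-+ n x))))
    ℤ∣.∣-refl)

  eval-≡mod : ∀ f {a b} → a ≡ b mod n → eval f a ≡ eval f b mod n
  eval-≡mod []      a≡b = ≡mod-refl ℤ.0ℤ
  eval-≡mod (h ∷ f) a≡b = ≡mod-+ (≡mod-refl h) (≡mod-* a≡b (eval-≡mod f a≡b))

  ≋mod-refl : ∀ {j} (v : Vec ℤ j) → v ≋ v mod n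
  ≋mod-refl v = Pointwise.refl (≡mod-refl _)

  vsum-≡mod : ∀ {j} {v w : Vec ℤ j} → v ≋ w mod n → vsum v ≡ vsum w mod n
  vsum-≡mod []          = ≡mod-refl ℤ.0ℤ
  vsum-≡mod (x≡y ∷ v≡w) = ≡mod-+ x≡y (vsum-≡mod v≡w)

allB-≋ : ∀ {n} {p : ℤ → Bool} → (∀ {x y} → x ≡ y mod n → p x ≡ p y) →
         ∀ {j} {v w : Vec ℤ j} → v ≋ w mod n → allB p v ≡ allB p w
allB-≋ p-cong []                        = refl
allB-≋ p-cong (_∷_ {x = x} x≡y v≋w) rewrite p-cong x≡y | allB-≋ p-cong v≋w = refl

residue-unique : ∀ {n a r} → a < n → r < n → + a ≡ + r mod n → a ≡ r
residue-unique {n} {a} {r} a<n r<n a≡r =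
  [ (λ r≤a → ordered a<n r≤a a≡r) , (λ a≤r → sym (ordered r<n a≤r (≡mod-sym a≡r))) ]′ (≤-total r a)
  where
  ordered : ∀ {a r} → a < n → r ≤ a → + a ≡ + r mod n → a ≡ r
  ordered {a} {r} a<n r≤a (congruent n∣a-r) =
    ≤-antisym (m∸n≡0⇒m≤n (∣∧<⇒≡0 n∣a∸r (≤-<-trans (m∸n≤m a r) a<n))) r≤a
    where
    ∣∧<⇒≡0 : ∀ {m} → n ∣ m → m < n → m ≡ 0
    ∣∧<⇒≡0 {zero}  _   _   = refl
    ∣∧<⇒≡0 {suc m} n∣m m<n = contradiction n∣m (>⇒∤ m<n)
    n∣a∸r : n ∣ a ∸ r
    n∣a∸r = subst (n ∣_) (cong ∣_∣ (trans (ℤP.[+m]-[+n]≡m⊖n a r) (ℤP.⊖-≥ r≤a))) (ℤ∣.∣⇒∣ᵤ n∣a-r)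

≡mod-%ℕ : ∀ n .{{_ : NonZero n}} t → t ≡ + (t ℤDivMod.%ℕ n) mod n
≡mod-%ℕ n t = congruent (subst (+ n ℤ∣.∣_) t-q*n≡t-r (ℤ∣.∣n⇒∣m*n q ℤ∣.∣-refl))
  where
  open ℤSolver.+-*-Solver
  q = t ℤDivMod./ℕ n
  t-q*n≡t-r : q ℤ.* + n ≡ t ℤ.- + (t ℤDivMod.%ℕ n)
  t-q*n≡t-r = trans (solve 2 (λ r m → m := (r :+ m) :- r) refl (+ (t ℤDivMod.%ℕ n)) (q ℤ.* + n))
                    (cong (ℤ._- + (t ℤDivMod.%ℕ n)) (sym (ℤDivMod.a≡a%ℕn+[a/ℕn]*n t n)))

-- Only the residue a of t modulo n satisfies n ∣ a - t.
sumBelow-residue : ∀ n .{{_ : NonZero n}} (u : ℤ → ℕ) → (∀ {x y} → x ≡ y mod n → u x ≡ u y) → ∀ t →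
  sumBelow n (λ a → u (+ a) * 𝟙 ⌊ (+ n) ∣ℤ? (+ a ℤ.- t) ⌋) ≡ u t
sumBelow-residue n u u-cong t = begin
  sumBelow n (λ a → u (+ a) * 𝟙 ⌊ (+ n) ∣ℤ? (+ a ℤ.- t) ⌋)
    ≡⟨ sumBelow-cong< n (λ a a<n → cong (λ b → u (+ a) * 𝟙 b) (divides⇔residue a a<n)) ⟩
  sumBelow n (λ a → u (+ a) * 𝟙 (a ≡ᵇ r))
    ≡⟨ sumBelow-indicator n (u ∘ +_) r<n ⟩
  u (+ r)
    ≡⟨ u-cong (≡mod-sym (≡mod-%ℕ n t)) ⟩
  u t ∎
  where
  r = t ℤDivMod.%ℕ n
  r<n : r < n
  r<n = ℤDivMod.n%ℕd<d t n
  divides⇔residue : ∀ a → a < n → ⌊ (+ n) ∣ℤ? (+ a ℤ.- t) ⌋ ≡ (a ≡ᵇ r)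
  divides⇔residue a a<n = isYes-T ((+ n) ∣ℤ? (+ a ℤ.- t)) (a ≡ᵇ r)
    (λ n∣a-t → ≡⇒≡ᵇ a r
      (residue-unique a<n r<n (≡mod-trans (congruent (ℤ∣.∣ᵤ⇒∣ n∣a-t)) (≡mod-%ℕ n t))))
    (λ a≡ᵇr → ℤ∣.∣⇒∣ᵤ (divides-difference (subst (λ x → + x ≡ t mod n) (sym (≡ᵇ⇒≡ a r a≡ᵇr))
                                              (≡mod-sym (≡mod-%ℕ n t)))))

-- Sums over tuples of residues

sumTuples : (n j : ℕ) → (Vec ℤ j → ℕ) → ℕ
sumTuples n zero    F = F []
sumTuples n (suc j) F = sumBelow n (λ a → sumTuples n j (F ∘ (+ a ∷_)))

sumTuples-cong : ∀ n j {F G : Vec ℤ j → ℕ} → (∀ v → F v ≡ G v) → sumTuples n j F ≡ sumTuples n j G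
sumTuples-cong n zero    eq = eq []
sumTuples-cong n (suc j) eq = sumBelow-cong n (λ a → sumTuples-cong n j (eq ∘ (+ a ∷_)))

sumTuples-+ : ∀ n j (F G : Vec ℤ j → ℕ) → sumTuples n j (λ v → F v + G v) ≡ sumTuples n j F + sumTuples n j G
sumTuples-+ n zero    F G = refl
sumTuples-+ n (suc j) F G = trans
  (sumBelow-cong n (λ a → sumTuples-+ n j (F ∘ (+ a ∷_)) (G ∘ (+ a ∷_)))) (sumBelow-+ n _ _)

sumTuples-const : ∀ n j c → sumTuples n j (λ _ → c) ≡ n ^ j * c
sumTuples-const n zero    c = sym (+-identityʳ c)
sumTuples-const n (suc j) c = trans (sumBelow-cong n (λ _ → sumTuples-const n j c))
  (trans (sumBelow-const n _) (sym (*-assoc n (n ^ j) c)))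

sumTuples-sumBelow : ∀ n m j (H : ℕ → Vec ℤ j → ℕ) →
  sumTuples n j (λ v → sumBelow m (λ a → H a v)) ≡ sumBelow m (λ a → sumTuples n j (H a))
sumTuples-sumBelow n m zero    H = refl
sumTuples-sumBelow n m (suc j) H = trans
  (sumBelow-cong n (λ b → sumTuples-sumBelow n m j (λ a → H a ∘ (+ b ∷_))))
  (sumBelow-swap n m (λ b a → sumTuples n j (H a ∘ (+ b ∷_))))

countTuples≡sumTuples : ∀ n k (P : Vec ℤ k → Bool) → countTuples n k P ≡ sumTuples n k (𝟙 ∘ P)
countTuples≡sumTuples n zero    P = refl
countTuples≡sumTuples n (suc k) P = trans
  (sum-residues (λ x → x) n (λ a → countTuples n k (P ∘ (a ∷_))))
  (sumBelow-cong n (λ a → countTuples≡sumTuples n k (P ∘ (+ a ∷_))))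
  where
  sum-residues : ∀ (f : ℕ → ℕ) n (g : ℤ → ℕ) →
    sum (List.map g (List.map +_ (applyUpTo f n))) ≡ sumBelow n (λ a → g (+ f a))
  sum-residues f zero    g = refl
  sum-residues f (suc n) g = cong (_+_ (g (+ f 0))) (sum-residues (f ∘ suc) n g)

ModInvariant : ℕ → ∀ {j} → (Vec ℤ j → ℕ) → Set
ModInvariant n F = ∀ {v w} → v ≋ w mod n → F v ≡ F w

module _ {n j} {F : Vec ℤ (suc j) → ℕ} (invariant : ModInvariant n F) where

  modInvariant-tail : ∀ a → ModInvariant n (F ∘ (a ∷_))
  modInvariant-tail a v≋w = invariant (≡mod-refl a ∷ v≋w)

  modInvariant⇒head-periodic : ∀ m → Periodic n (λ a → sumTuples m j (F ∘ (+ a ∷_)))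
  modInvariant⇒head-periodic m a = sumTuples-cong m j (λ v → invariant (n+x≡x-mod-n a ∷ ≋mod-refl v))

sumTuples-periodic : ∀ m n j (F : Vec ℤ j → ℕ) → ModInvariant n F →
                     sumTuples (m * n) j F ≡ m ^ j * sumTuples n j F
sumTuples-periodic m n zero    F invariant = sym (+-identityʳ _)
sumTuples-periodic m n (suc j) F invariant = begin
  sumBelow (m * n) (λ a → sumTuples (m * n) j (F ∘ (+ a ∷_)))
    ≡⟨ sumBelow-cong (m * n) (λ a → sumTuples-periodic m n j _ (modInvariant-tail invariant (+ a))) ⟩
  sumBelow (m * n) (λ a → m ^ j * sumTuples n j (F ∘ (+ a ∷_)))
    ≡⟨ sumBelow-*ˡ (m * n) (m ^ j) _ ⟩
  m ^ j * sumBelow (m * n) (λ a → sumTuples n j (F ∘ (+ a ∷_)))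
    ≡⟨ cong (m ^ j *_) (sumBelow-periodic m (modInvariant⇒head-periodic invariant n)) ⟩
  m ^ j * (m * sumTuples n (suc j) F)
    ≡⟨ *-assoc (m ^ j) m _ ⟨
  m ^ j * m * sumTuples n (suc j) F
    ≡⟨ cong (_* sumTuples n (suc j) F) (*-comm (m ^ j) m) ⟩
  m ^ suc j * sumTuples n (suc j) F ∎

sumTuples-coprime-* : ∀ j m n (F G : Vec ℤ j → ℕ) → .{{NonZero m}} → Coprime m n →
  ModInvariant m F → ModInvariant n G →
  sumTuples (m * n) j (λ v → F v * G v) ≡ sumTuples m j F * sumTuples n j G
sumTuples-coprime-* zero    m n F G cop invF invG = refl
sumTuples-coprime-* (suc j) m n F G cop invF invG = trans
  (sumBelow-cong (m * n) (λ a → sumTuples-coprime-* j m n _ _ cop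
    (modInvariant-tail invF (+ a)) (modInvariant-tail invG (+ a))))
  (sumBelow-coprime-* m n _ _ cop (modInvariant⇒head-periodic invF m) (modInvariant⇒head-periodic invG n))

-- Exunits

coprime-∣ʳ : ∀ {x n d} → Coprime x n → d ∣ n → Coprime x d
coprime-∣ʳ cop d∣n (i∣x , i∣d) = cop (i∣x , ∣-trans i∣d d∣n)

coprime-*ʳ : ∀ {x} m n → Coprime x m → Coprime x n → Coprime x (m * n)
coprime-*ʳ m n cm cn (i∣x , i∣mn) =
  cn (i∣x , coprime-divisor (λ (j∣i , j∣m) → cm (∣-trans j∣i i∣x , j∣m)) i∣mn)

coprime-prime⇒∤ : ∀ {x p} → Prime p → Coprime x p → ¬ p ∣ x
coprime-prime⇒∤ pr cop p∣x = ¬prime[1] (subst Prime (cop (p∣x , ∣-refl)) pr)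

∤⇒coprime-prime : ∀ {x p} → Prime p → ¬ p ∣ x → Coprime x p
∤⇒coprime-prime pr p∤x (i∣x , i∣p) with prime⇒irreducible pr i∣p
... | inj₁ i≡1 = i≡1
... | inj₂ refl = contradiction i∣x p∤x

coprime-≡mod : ∀ {n x y} → x ≡ y mod n → Coprime ∣ x ∣ n → Coprime ∣ y ∣ n
coprime-≡mod {n} {x} {y} (congruent n∣x-y) cop {i} (i∣y , i∣n) = cop (ℤ∣.∣⇒∣ᵤ i∣x , i∣n)
  where
  open ℤSolver.+-*-Solver
  i∣x : + i ℤ∣.∣ x
  i∣x = subst (+ i ℤ∣.∣_) (solve 2 (λ x y → (x :- y) :+ y := x) refl x y)
          (ℤ∣.∣m∣n⇒∣m+n (ℤ∣.∣-trans (ℤ∣.∣ᵤ⇒∣ i∣n) n∣x-y) (ℤ∣.∣ᵤ⇒∣ i∣y))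

exunit : Poly → ℕ → ℤ → Bool
exunit f n a = ⌊ isExunit? f n a ⌋

module _ (f : Poly) where

  exunit≡coprime : ∀ n a → exunit f n a ≡ ⌊ coprime? ∣ eval f a ∣ n ⌋
  exunit≡coprime n a = isYes-⇔ (isExunit? f n a) (coprime? ∣ eval f a ∣ n)
    (λ gcd≡1 → gcd≡1⇒coprime (ℤP.+-injective gcd≡1)) (λ cop → cong +_ (coprime⇒gcd≡1 cop))

  exunit-cong : ∀ {n a b} → a ≡ b mod n → exunit f n a ≡ exunit f n b
  exunit-cong {n} {a} {b} a≡b = begin
    exunit f n a                       ≡⟨ exunit≡coprime n a ⟩
    ⌊ coprime? ∣ eval f a ∣ n ⌋         ≡⟨ isYes-⇔ (coprime? _ n) (coprime? _ n) (coprime-≡mod fa≡fb)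
                                                                           (coprime-≡mod (≡mod-sym fa≡fb)) ⟩
    ⌊ coprime? ∣ eval f b ∣ n ⌋         ≡⟨ exunit≡coprime n b ⟨
    exunit f n b                       ∎
    where
    fa≡fb = eval-≡mod f a≡b

  exunit-* : ∀ m n a → exunit f (m * n) a ≡ exunit f m a ∧ exunit f n a
  exunit-* m n a = begin
    exunit f (m * n) a
      ≡⟨ exunit≡coprime (m * n) a ⟩
    ⌊ coprime? x (m * n) ⌋
      ≡⟨ isYes-⇔ (coprime? x (m * n)) (coprime? x m ×-dec coprime? x n)
           (λ cop → coprime-∣ʳ cop (m∣m*n n) , coprime-∣ʳ cop (n∣m*n m))
           (λ (cm , cn) → coprime-*ʳ m n cm cn) ⟩
    ⌊ coprime? x m ×-dec coprime? x n ⌋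
      ≡⟨ isYes-× (coprime? x m) (coprime? x n) ⟩
    ⌊ coprime? x m ⌋ ∧ ⌊ coprime? x n ⌋
      ≡⟨ cong₂ _∧_ (exunit≡coprime m a) (exunit≡coprime n a) ⟨
    exunit f m a ∧ exunit f n a ∎
    where
    x = ∣ eval f a ∣

  exunit-*-∣ : ∀ {d n} a → d ∣ n → exunit f (d * n) a ≡ exunit f n a
  exunit-*-∣ {d} {n} a d∣n = begin
    exunit f (d * n) a             ≡⟨ exunit≡coprime (d * n) a ⟩
    ⌊ coprime? x (d * n) ⌋         ≡⟨ isYes-⇔ (coprime? x (d * n)) (coprime? x n)
                                        (λ cop → coprime-∣ʳ cop (n∣m*n d))
                                        (λ cop → coprime-*ʳ d n (coprime-∣ʳ cop d∣n) cop) ⟩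
    ⌊ coprime? x n ⌋               ≡⟨ exunit≡coprime n a ⟨
    exunit f n a                   ∎
    where
    x = ∣ eval f a ∣

  exunit-1 : ∀ a → exunit f 1 a ≡ true
  exunit-1 a = trans (exunit≡coprime 1 a) (isYes-T (coprime? _ 1) true (λ _ → tt) (λ _ → Coprime.sym (1-coprimeTo _)))

  exunit-prime : ∀ {p} a → Prime p → exunit f p a ≡ not ⌊ (+ p) ∣ℤ? eval f a ⌋
  exunit-prime {p} a pr = begin
    exunit f p a                   ≡⟨ exunit≡coprime p a ⟩
    ⌊ coprime? x p ⌋               ≡⟨ isYes-⇔ (coprime? x p) (¬? (p ∣? x))
                                                (coprime-prime⇒∤ pr) (∤⇒coprime-prime pr) ⟩
    ⌊ ¬? (p ∣? x) ⌋                ≡⟨ isYes-¬ (p ∣? x) ⟩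
    not ⌊ p ∣? x ⌋                 ∎
    where
    x = ∣ eval f a ∣

module _ {p : ℕ} (pr : Prime p) where

  prime-∣ℤ?-* : ∀ x y → ⌊ (+ p) ∣ℤ? (x ℤ.* y) ⌋ ≡ ⌊ (+ p) ∣ℤ? x ⌋ ∨ ⌊ (+ p) ∣ℤ? y ⌋
  prime-∣ℤ?-* x y = trans
    (isYes-⇔ (p ∣? ∣ x ℤ.* y ∣) ((p ∣? ∣ x ∣) ⊎-dec (p ∣? ∣ y ∣))
      (λ p∣xy → euclidsLemma ∣ x ∣ ∣ y ∣ pr (subst (p ∣_) (ℤP.abs-* x y) p∣xy))
      (λ p∣x⊎p∣y → subst (p ∣_) (sym (ℤP.abs-* x y)) (∣-product p∣x⊎p∣y)))
    (isYes-⊎ (p ∣? ∣ x ∣) (p ∣? ∣ y ∣))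
    where
    ∣-product : (p ∣ ∣ x ∣) ⊎ (p ∣ ∣ y ∣) → p ∣ ∣ x ∣ * ∣ y ∣
    ∣-product (inj₁ p∣x) = ∣-trans p∣x (m∣m*n ∣ y ∣)
    ∣-product (inj₂ p∣y) = ∣-trans p∣y (n∣m*n ∣ x ∣)

  prime-∣ℤ?-1 : ⌊ (+ p) ∣ℤ? ℤ.1ℤ ⌋ ≡ false
  prime-∣ℤ?-1 = isYes-T (p ∣? 1) false (λ p∣1 → ¬prime[1] (subst Prime (∣1⇒≡1 p∣1) pr)) (λ ())

module Counting (f : Poly) (c : ℤ) where

  -- 1 iff the tuple (c − Σ v) ∷ v is counted by 𝒩(n)
  admissible : ℕ → ∀ {j} → Vec ℤ j → ℕ
  admissible n v = 𝟙 (allB (exunit f n) v) * 𝟙 (exunit f n (c ℤ.- vsum v))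

  vanishing : ℕ → ∀ {j} → Vec ℤ j → ℕ
  vanishing p v = 𝟙 ⌊ (+ p) ∣ℤ? (vprod (Vec.map (eval f) v) ℤ.* eval f (c ℤ.- vsum v)) ⌋

  𝒩≡sumTuples-admissible : ∀ j n .{{_ : NonZero n}} → 𝒩 (suc j) f c n ≡ sumTuples n j (admissible n)
  𝒩≡sumTuples-admissible j n = begin
    𝒩 (suc j) f c n
      ≡⟨ countTuples≡sumTuples n (suc j) P ⟩
    sumBelow n (λ a → sumTuples n j (λ v → 𝟙 (P (+ a ∷ v))))
      ≡⟨ sumTuples-sumBelow n n j (λ a v → 𝟙 (P (+ a ∷ v))) ⟨
    sumTuples n j (λ v → sumBelow n (λ a → 𝟙 (P (+ a ∷ v))))
      ≡⟨ sumTuples-cong n j head-forced ⟩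
    sumTuples n j (admissible n) ∎
    where
    P : Vec ℤ (suc j) → Bool
    P xs = if allB (exunit f n) xs then ⌊ (+ n) ∣ℤ? (vsum xs ℤ.- c) ⌋ else false
    head-forced : ∀ v → sumBelow n (λ a → 𝟙 (P (+ a ∷ v))) ≡ admissible n v
    head-forced v = begin
      sumBelow n (λ a → 𝟙 (P (+ a ∷ v)))
        ≡⟨ sumBelow-cong n (λ a → 𝟙-if-if (E (+ a)) (allB E v) _) ⟩
      sumBelow n (λ a → 𝟙 (allB E v) * (𝟙 (E (+ a)) * sums-to-c a))
        ≡⟨ sumBelow-*ˡ n (𝟙 (allB E v)) _ ⟩
      𝟙 (allB E v) * sumBelow n (λ a → 𝟙 (E (+ a)) * sums-to-c a)
        ≡⟨ cong (𝟙 (allB E v) *_) head-is-residue ⟩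
      admissible n v ∎
      where
      E = exunit f n
      sums-to-c : ℕ → ℕ
      sums-to-c a = 𝟙 ⌊ (+ n) ∣ℤ? ((+ a ℤ.+ vsum v) ℤ.- c) ⌋
      regroup : ∀ a s c → (a ℤ.+ s) ℤ.- c ≡ a ℤ.- (c ℤ.- s)
      regroup = solve 3 (λ a s c → (a :+ s) :- c := a :- (c :- s)) refl
        where open ℤSolver.+-*-Solver
      head-is-residue : sumBelow n (λ a → 𝟙 (E (+ a)) * sums-to-c a) ≡ 𝟙 (E (c ℤ.- vsum v))
      head-is-residue = trans
        (sumBelow-cong n (λ a → cong (λ x → 𝟙 (E (+ a)) * 𝟙 ⌊ (+ n) ∣ℤ? x ⌋) (regroup (+ a) (vsum v) c)))
        (sumBelow-residue n (𝟙 ∘ E) (cong 𝟙 ∘ exunit-cong f) (c ℤ.- vsum v))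

  𝓜≡sumTuples-vanishing : ∀ j p → 𝓜 (suc j) f c p ≡ sumTuples p j (vanishing p)
  𝓜≡sumTuples-vanishing j p = countTuples≡sumTuples p j _

  admissible-modInvariant : ∀ n {j} → ModInvariant n (admissible n {j})
  admissible-modInvariant n v≋w = cong₂ (λ a b → 𝟙 a * 𝟙 b)
    (allB-≋ (exunit-cong f) v≋w) (exunit-cong f (≡mod-- c (vsum-≡mod v≋w)))

  admissible-* : ∀ m n {j} (v : Vec ℤ j) → admissible (m * n) v ≡ admissible m v * admissible n v
  admissible-* m n v = begin
    𝟙 (allB (exunit f (m * n)) v) * 𝟙 (exunit f (m * n) t)
      ≡⟨ cong₂ (λ a b → 𝟙 a * 𝟙 b) (allB-∧ (exunit-* f m n) v) (exunit-* f m n t) ⟩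
    𝟙 (allB (exunit f m) v ∧ allB (exunit f n) v) * 𝟙 (exunit f m t ∧ exunit f n t)
      ≡⟨ cong₂ _*_ (𝟙-∧ (allB (exunit f m) v) _) (𝟙-∧ (exunit f m t) _) ⟩
    (𝟙 (allB (exunit f m) v) * 𝟙 (allB (exunit f n) v)) * (𝟙 (exunit f m t) * 𝟙 (exunit f n t))
      ≡⟨ [m*n]*[o*p]≡[m*o]*[n*p] (𝟙 (allB (exunit f m) v)) (𝟙 (allB (exunit f n) v))
                                 (𝟙 (exunit f m t)) (𝟙 (exunit f n t)) ⟩
    admissible m v * admissible n v ∎
    where
    t = c ℤ.- vsum v

  admissible-*-∣ : ∀ {d n} → d ∣ n → ∀ {j} (v : Vec ℤ j) → admissible (d * n) v ≡ admissible n v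
  admissible-*-∣ d∣n v = cong₂ (λ a b → 𝟙 a * 𝟙 b)
    (allB-cong (λ a → exunit-*-∣ f a d∣n) v) (exunit-*-∣ f (c ℤ.- vsum v) d∣n)

  admissible-1 : ∀ {j} (v : Vec ℤ j) → admissible 1 v ≡ 1
  admissible-1 v = cong₂ (λ a b → 𝟙 a * 𝟙 b) (allB-true (exunit-1 f) v) (exunit-1 f (c ℤ.- vsum v))

  module _ {p} (pr : Prime p) where

    allB-exunit-prime : ∀ {j} (v : Vec ℤ j) → allB (exunit f p) v ≡ not ⌊ (+ p) ∣ℤ? vprod (Vec.map (eval f) v) ⌋
    allB-exunit-prime []      = cong not (sym (prime-∣ℤ?-1 pr))
    allB-exunit-prime (x ∷ v)
      rewrite exunit-prime f x pr | allB-exunit-prime v | prime-∣ℤ?-* pr (eval f x) (vprod (Vec.map (eval f) v))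
      with ⌊ (+ p) ∣ℤ? eval f x ⌋
    ... | true  = refl
    ... | false = refl

    admissible+vanishing≡1 : ∀ {j} (v : Vec ℤ j) → admissible p v + vanishing p v ≡ 1
    admissible+vanishing≡1 v
      rewrite allB-exunit-prime v | exunit-prime f (c ℤ.- vsum v) pr
            | prime-∣ℤ?-* pr (vprod (Vec.map (eval f) v)) (eval f (c ℤ.- vsum v))
      with ⌊ (+ p) ∣ℤ? vprod (Vec.map (eval f) v) ⌋ | ⌊ (+ p) ∣ℤ? eval f (c ℤ.- vsum v) ⌋
    ... | true  | _     = refl
    ... | false | true  = refl
    ... | false | false = refl

  module _ (j : ℕ) where

    𝒩-1 : 𝒩 (suc j) f c 1 ≡ 1
    𝒩-1 = begin
      𝒩 (suc j) f c 1                ≡⟨ 𝒩≡sumTuples-admissible j 1 ⟩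
      sumTuples 1 j (admissible 1)   ≡⟨ sumTuples-cong 1 j admissible-1 ⟩
      sumTuples 1 j (λ _ → 1)        ≡⟨ sumTuples-const 1 j 1 ⟩
      1 ^ j * 1                      ≡⟨ trans (*-identityʳ (1 ^ j)) (^-zeroˡ j) ⟩
      1                              ∎

    𝒩-coprime-* : ∀ m n .{{_ : NonZero m}} .{{_ : NonZero n}} → Coprime m n →
                  𝒩 (suc j) f c (m * n) ≡ 𝒩 (suc j) f c m * 𝒩 (suc j) f c n
    𝒩-coprime-* m n cop = begin
      𝒩 (suc j) f c (m * n)
        ≡⟨ 𝒩≡sumTuples-admissible j (m * n) {{m*n≢0 m n}} ⟩
      sumTuples (m * n) j (admissible (m * n))
        ≡⟨ sumTuples-cong (m * n) j (admissible-* m n) ⟩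
      sumTuples (m * n) j (λ v → admissible m v * admissible n v)
        ≡⟨ sumTuples-coprime-* j m n _ _ cop (admissible-modInvariant m) (admissible-modInvariant n) ⟩
      sumTuples m j (admissible m) * sumTuples n j (admissible n)
        ≡⟨ cong₂ _*_ (𝒩≡sumTuples-admissible j m) (𝒩≡sumTuples-admissible j n) ⟨
      𝒩 (suc j) f c m * 𝒩 (suc j) f c n ∎

    𝒩-*-∣ : ∀ d n .{{_ : NonZero d}} .{{_ : NonZero n}} → d ∣ n → 𝒩 (suc j) f c (d * n) ≡ d ^ j * 𝒩 (suc j) f c n
    𝒩-*-∣ d n d∣n = begin
      𝒩 (suc j) f c (d * n)
        ≡⟨ 𝒩≡sumTuples-admissible j (d * n) {{m*n≢0 d n}} ⟩
      sumTuples (d * n) j (admissible (d * n))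
        ≡⟨ sumTuples-cong (d * n) j (admissible-*-∣ d∣n) ⟩
      sumTuples (d * n) j (admissible n)
        ≡⟨ sumTuples-periodic d n j _ (admissible-modInvariant n) ⟩
      d ^ j * sumTuples n j (admissible n)
        ≡⟨ cong (d ^ j *_) (𝒩≡sumTuples-admissible j n) ⟨
      d ^ j * 𝒩 (suc j) f c n ∎

    𝒩+𝓜≡p^j : ∀ p → Prime p → 𝒩 (suc j) f c p + 𝓜 (suc j) f c p ≡ p ^ j
    𝒩+𝓜≡p^j p pr = begin
      𝒩 (suc j) f c p + 𝓜 (suc j) f c p
        ≡⟨ cong₂ _+_ (𝒩≡sumTuples-admissible j p {{prime⇒nonZero pr}}) (𝓜≡sumTuples-vanishing j p) ⟩
      sumTuples p j (admissible p) + sumTuples p j (vanishing p)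
        ≡⟨ sumTuples-+ p j (admissible p) (vanishing p) ⟨
      sumTuples p j (λ v → admissible p v + vanishing p v)
        ≡⟨ sumTuples-cong p j (admissible+vanishing≡1 pr) ⟩
      sumTuples p j (λ _ → 1)
        ≡⟨ trans (sumTuples-const p j 1) (*-identityʳ (p ^ j)) ⟩
      p ^ j ∎

-- The product formula

fromℕ : ℕ → ℚ
fromℕ n = + n / 1

private
  toℚᵘ-fromℕ : ∀ n → toℚᵘ (fromℕ n) ℚᵘ.≃ ℚᵘ.mkℚᵘ (+ n) 0
  toℚᵘ-fromℕ n = ℚP.toℚᵘ-fromℚᵘ (ℚᵘ.mkℚᵘ (+ n) 0)

fromℕ-+ : ∀ a b → fromℕ (a + b) ≡ fromℕ a ℚ.+ fromℕ b
fromℕ-+ a b = ℚP.toℚᵘ-injective (ℚᵘP.≃-trans (toℚᵘ-fromℕ (a + b)) (ℚᵘP.≃-trans (ℚᵘ.*≡* numerators)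
  (ℚᵘP.≃-sym (ℚᵘP.≃-trans (ℚP.toℚᵘ-homo-+ (fromℕ a) (fromℕ b))
                          (ℚᵘP.+-cong (toℚᵘ-fromℕ a) (toℚᵘ-fromℕ b))))))
  where
  numerators : + (a + b) ℤ.* + 1 ≡ (+ a ℤ.* + 1 ℤ.+ + b ℤ.* + 1) ℤ.* + 1
  numerators = cong (ℤ._* + 1) (trans (ℤP.pos-+ a b)
                 (sym (cong₂ ℤ._+_ (ℤP.*-identityʳ (+ a)) (ℤP.*-identityʳ (+ b)))))

fromℕ-* : ∀ a b → fromℕ (a * b) ≡ fromℕ a ℚ.* fromℕ b
fromℕ-* a b = ℚP.toℚᵘ-injective (ℚᵘP.≃-trans (toℚᵘ-fromℕ (a * b)) (ℚᵘP.≃-trans (ℚᵘ.*≡* numerators)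
  (ℚᵘP.≃-sym (ℚᵘP.≃-trans (ℚP.toℚᵘ-homo-* (fromℕ a) (fromℕ b))
                          (ℚᵘP.*-cong (toℚᵘ-fromℕ a) (toℚᵘ-fromℕ b))))))
  where
  numerators : + (a * b) ℤ.* + 1 ≡ (+ a ℤ.* + b) ℤ.* + 1
  numerators = cong (ℤ._* + 1) (ℤP.pos-* a b)

fromℕ-*-/ : ∀ m n .{{_ : NonZero n}} → fromℕ n ℚ.* (+ m / n) ≡ fromℕ m
fromℕ-*-/ m (suc n) = ℚP.toℚᵘ-injective (ℚᵘP.≃-trans (ℚP.toℚᵘ-homo-* (fromℕ (suc n)) (+ m / suc n))
  (ℚᵘP.≃-trans (ℚᵘP.*-cong (toℚᵘ-fromℕ (suc n)) (ℚP.toℚᵘ-fromℚᵘ (ℚᵘ.mkℚᵘ (+ m) n)))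
  (ℚᵘP.≃-trans (ℚᵘ.*≡* cross-multiply) (ℚᵘP.≃-sym (toℚᵘ-fromℕ m)))))
  where
  cross-multiply : (+ suc n ℤ.* + m) ℤ.* + 1 ≡ + m ℤ.* + suc (n + 0)
  cross-multiply = trans (ℤP.*-identityʳ _) (trans (ℤP.*-comm (+ suc n) (+ m))
                     (cong (λ z → + m ℤ.* + suc z) (sym (+-identityʳ n))))

fromℕ-complement : ∀ a b c .{{_ : NonZero c}} → a + b ≡ c → fromℕ a ≡ fromℕ c ℚ.* (1ℚ ℚ.- + b / c)
fromℕ-complement a b c a+b≡c = begin
  fromℕ a                                ≡⟨ solve 2 (λ a b → a := (a :+ b) :- b) refl (fromℕ a) (fromℕ b) ⟩
  (fromℕ a ℚ.+ fromℕ b) ℚ.- fromℕ b       ≡⟨ cong (ℚ._- fromℕ b) (trans (sym (fromℕ-+ a b)) (cong fromℕ a+b≡c)) ⟩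
  fromℕ c ℚ.- fromℕ b                    ≡⟨ cong (λ y → fromℕ c ℚ.- y) (fromℕ-*-/ b c) ⟨
  fromℕ c ℚ.- fromℕ c ℚ.* x              ≡⟨ solve 2 (λ c x → c :- c :* x := c :* (con 1ℚ :- x)) refl (fromℕ c) x ⟩
  fromℕ c ℚ.* (1ℚ ℚ.- x)                 ∎
  where
  open ℚSolver.+-*-Solver
  x = + b / c

IsPrimeDivisor : ℕ → ℕ → Set
IsPrimeDivisor n x = Prime x × x ∣ n

isPrimeDivisor? : ∀ n x → Dec (IsPrimeDivisor n x)
isPrimeDivisor? n x = prime? x ×-dec x ∣? n

module PrimeDivisorProduct (g : ℕ → ℚ) where

  factorIf : ∀ {P : Set} → Dec P → ℚ → ℚ
  factorIf (yes _) q = q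
  factorIf (no  _) _ = 1ℚ

  term : ℕ → ℕ → ℚ
  term n x = factorIf (isPrimeDivisor? n x) (g x)

  ∏ : ℕ → List ℕ → ℚ
  ∏ n []       = 1ℚ
  ∏ n (x ∷ xs) = term n x ℚ.* ∏ n xs

  term-yes : ∀ {n x} → IsPrimeDivisor n x → term n x ≡ g x
  term-yes {n} {x} x∣n with isPrimeDivisor? n x
  ... | yes _   = refl
  ... | no  x∤n = contradiction x∣n x∤n

  term-no : ∀ {n x} → ¬ IsPrimeDivisor n x → term n x ≡ 1ℚ
  term-no {n} {x} x∤n with isPrimeDivisor? n x
  ... | yes x∣n = contradiction x∣n x∤n
  ... | no  _   = refl

  foldr-filter≡∏ : ∀ n xs →
    List.foldr ℚ._*_ 1ℚ (List.map g (filter (isPrimeDivisor? n) xs)) ≡ ∏ n xs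
  foldr-filter≡∏ n []       = refl
  foldr-filter≡∏ n (x ∷ xs) with isPrimeDivisor? n x
  ... | yes x∣n = trans (cong (List.foldr ℚ._*_ 1ℚ ∘ List.map g) (filter-accept (isPrimeDivisor? n) x∣n))
                        (cong (g x ℚ.*_) (foldr-filter≡∏ n xs))
  ... | no  x∤n = trans (cong (List.foldr ℚ._*_ 1ℚ ∘ List.map g) (filter-reject (isPrimeDivisor? n) x∤n))
                        (trans (foldr-filter≡∏ n xs) (sym (ℚP.*-identityˡ _)))

  ∏-∷ʳ : ∀ n xs x → ∏ n (xs ∷ʳ x) ≡ ∏ n xs ℚ.* term n x
  ∏-∷ʳ n []       x = trans (ℚP.*-identityʳ (term n x)) (sym (ℚP.*-identityˡ (term n x)))
  ∏-∷ʳ n (y ∷ xs) x = trans (cong (term n y ℚ.*_) (∏-∷ʳ n xs x))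
                            (sym (ℚP.*-assoc (term n y) (∏ n xs) (term n x)))

  ∏-upTo-suc : ∀ n N → ∏ n (upTo (suc N)) ≡ ∏ n (upTo N) ℚ.* term n N
  ∏-upTo-suc n N = trans (cong (∏ n) (sym (upTo-∷ʳ N))) (∏-∷ʳ n (upTo N) N)

  ∏-upTo-trivial : ∀ n N → (∀ x → x < N → ¬ IsPrimeDivisor n x) → ∏ n (upTo N) ≡ 1ℚ
  ∏-upTo-trivial n zero    _       = refl
  ∏-upTo-trivial n (suc N) trivial = begin
    ∏ n (upTo (suc N))          ≡⟨ ∏-upTo-suc n N ⟩
    ∏ n (upTo N) ℚ.* term n N   ≡⟨ cong₂ ℚ._*_ (∏-upTo-trivial n N (λ x x<N → trivial x (m<n⇒m<1+n x<N)))
                                               (term-no (trivial N ≤-refl)) ⟩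
    1ℚ ℚ.* 1ℚ                   ≡⟨ ℚP.*-identityˡ 1ℚ ⟩
    1ℚ                          ∎

  -- no x > n divides n ≠ 0
  ∏-upTo-beyond : ∀ n .{{_ : NonZero n}} {N} → suc n ≤′ N → ∏ n (upTo N) ≡ ∏ n (upTo (suc n))
  ∏-upTo-beyond n ≤′-refl                = refl
  ∏-upTo-beyond n (≤′-step {N} suc-n≤′N) = begin
    ∏ n (upTo (suc N))            ≡⟨ ∏-upTo-suc n N ⟩
    ∏ n (upTo N) ℚ.* term n N     ≡⟨ cong (∏ n (upTo N) ℚ.*_)
                                         (term-no (λ (_ , N∣n) → >⇒∤ (≤′⇒≤ suc-n≤′N) N∣n)) ⟩
    ∏ n (upTo N) ℚ.* 1ℚ           ≡⟨ ℚP.*-identityʳ _ ⟩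
    ∏ n (upTo N)                  ≡⟨ ∏-upTo-beyond n suc-n≤′N ⟩
    ∏ n (upTo (suc n))            ∎

  ∏-cong : ∀ {n n′} → (∀ {x} → IsPrimeDivisor n x → IsPrimeDivisor n′ x) →
           (∀ {x} → IsPrimeDivisor n′ x → IsPrimeDivisor n x) → ∀ xs → ∏ n xs ≡ ∏ n′ xs
  ∏-cong to from []       = refl
  ∏-cong {n} {n′} to from (x ∷ xs) = cong₂ ℚ._*_ term-cong (∏-cong to from xs)
    where
    term-cong : term n x ≡ term n′ x
    term-cong with isPrimeDivisor? n x | isPrimeDivisor? n′ x
    ... | yes _   | yes _    = refl
    ... | yes x∣n | no  x∤n′ = contradiction (to x∣n) x∤n′
    ... | no  x∤n | yes x∣n′ = contradiction (from x∣n′) x∤n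
    ... | no  _   | no  _    = refl

  term-coprime-* : ∀ {m n} → Coprime m n → ∀ x → term (m * n) x ≡ term m x ℚ.* term n x
  term-coprime-* {m} {n} cop x with isPrimeDivisor? m x | isPrimeDivisor? n x
  ... | yes (px , x∣m) | yes (_ , x∣n) = contradiction (subst Prime (cop (x∣m , x∣n)) px) ¬prime[1]
  ... | yes (px , x∣m) | no  _         = trans (term-yes (px , ∣-trans x∣m (m∣m*n n))) (sym (ℚP.*-identityʳ (g x)))
  ... | no  _          | yes (px , x∣n) = trans (term-yes (px , ∣-trans x∣n (n∣m*n m))) (sym (ℚP.*-identityˡ (g x)))
  ... | no  x∤m        | no  x∤n       = term-no (λ (px , x∣mn) →
    [ (λ x∣m → x∤m (px , x∣m)) , (λ x∣n → x∤n (px , x∣n)) ] (euclidsLemma m n px x∣mn))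

  ∏-coprime-* : ∀ {m n} → Coprime m n → ∀ xs → ∏ (m * n) xs ≡ ∏ m xs ℚ.* ∏ n xs
  ∏-coprime-* cop []       = sym (ℚP.*-identityˡ 1ℚ)
  ∏-coprime-* {m} {n} cop (x ∷ xs) =
    trans (cong₂ ℚ._*_ (term-coprime-* cop x) (∏-coprime-* cop xs))
          (ℚ-*-interchange (term m x) (term n x) (∏ m xs) (∏ n xs))

  ∏-primeDivisors : ℕ → ℚ
  ∏-primeDivisors n = ∏ n (upTo (suc n))

  ∏-primeDivisors-1 : ∏-primeDivisors 1 ≡ 1ℚ
  ∏-primeDivisors-1 = ∏-upTo-trivial 1 2 below-2
    where
    below-2 : ∀ x → x < 2 → ¬ IsPrimeDivisor 1 x
    below-2 0 _ (p0 , _) = ¬prime[0] p0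
    below-2 1 _ (p1 , _) = ¬prime[1] p1
    below-2 (suc (suc _)) (s≤s (s≤s ()))

  ∏-primeDivisors-prime : ∀ {p} → Prime p → ∏-primeDivisors p ≡ g p
  ∏-primeDivisors-prime {p} pr = begin
    ∏ p (upTo (suc p))          ≡⟨ ∏-upTo-suc p p ⟩
    ∏ p (upTo p) ℚ.* term p p   ≡⟨ cong₂ ℚ._*_ (∏-upTo-trivial p p below-p) (term-yes (pr , ∣-refl)) ⟩
    1ℚ ℚ.* g p                  ≡⟨ ℚP.*-identityˡ (g p) ⟩
    g p                         ∎
    where
    below-p : ∀ x → x < p → ¬ IsPrimeDivisor p x
    below-p x x<p (px , x∣p) with prime⇒irreducible pr x∣p
    ... | inj₁ refl = ¬prime[1] px
    ... | inj₂ refl = <-irrefl refl x<p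

  ∏-primeDivisors-*-∣ : ∀ d n .{{_ : NonZero d}} .{{_ : NonZero n}} → d ∣ n →
                        ∏-primeDivisors (d * n) ≡ ∏-primeDivisors n
  ∏-primeDivisors-*-∣ d n d∣n = begin
    ∏ (d * n) U     ≡⟨ ∏-cong (λ (px , x∣dn) → px , prime-divides-*-∣ px x∣dn)
                             (λ (px , x∣n) → px , ∣-trans x∣n (n∣m*n d)) U ⟩
    ∏ n U           ≡⟨ ∏-upTo-beyond n (≤⇒≤′ (s≤s (m≤n*m n d))) ⟩
    ∏-primeDivisors n ∎
    where
    U = upTo (suc (d * n))
    prime-divides-*-∣ : ∀ {x} → Prime x → x ∣ d * n → x ∣ n
    prime-divides-*-∣ px x∣dn = [ (λ x∣d → ∣-trans x∣d d∣n) , (λ x∣n → x∣n) ] (euclidsLemma d n px x∣dn)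

  ∏-primeDivisors-coprime-* : ∀ m n .{{_ : NonZero m}} .{{_ : NonZero n}} → Coprime m n →
                              ∏-primeDivisors (m * n) ≡ ∏-primeDivisors m ℚ.* ∏-primeDivisors n
  ∏-primeDivisors-coprime-* m n cop = begin
    ∏ (m * n) U                               ≡⟨ ∏-coprime-* cop U ⟩
    ∏ m U ℚ.* ∏ n U                           ≡⟨ cong₂ ℚ._*_ (∏-upTo-beyond m (≤⇒≤′ (s≤s (m≤m*n m n))))
                                                             (∏-upTo-beyond n (≤⇒≤′ (s≤s (m≤n*m n m)))) ⟩
    ∏-primeDivisors m ℚ.* ∏-primeDivisors n   ∎
    where
    U = upTo (suc (m * n))

^-distribʳ-* : ∀ m n j → (m * n) ^ j ≡ m ^ j * n ^ j
^-distribʳ-* m n zero    = refl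
^-distribʳ-* m n (suc j) = trans (cong (m * n *_) (^-distribʳ-* m n j)) ([m*n]*[o*p]≡[m*o]*[n*p] m n (m ^ j) (n ^ j))

-- Functions determined by their values at primes

-- F n / n ^ j is multiplicative and depends only on the prime divisors of n
record RadicalHomogeneous (j : ℕ) (F : ℕ → ℚ) : Set where
  field
    at-1      : F 1 ≡ 1ℚ
    coprime-* : ∀ m n .{{_ : NonZero m}} .{{_ : NonZero n}} → Coprime m n → F (m * n) ≡ F m ℚ.* F n
    *-∣       : ∀ d n .{{_ : NonZero d}} .{{_ : NonZero n}} → d ∣ n → F (d * n) ≡ fromℕ (d ^ j) ℚ.* F n

determined-by-primes : ∀ {j F G} → RadicalHomogeneous j F → RadicalHomogeneous j G →
                       (∀ p → Prime p → F p ≡ G p) → ∀ n .{{_ : NonZero n}} → F n ≡ G n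
determined-by-primes {j} {F} {G} homF homG F≡G-on-primes n =
  subst (λ m → F m ≡ G m) (sym (isFactorisation fact)) (on-products (factors fact) (factorsPrime fact))
  where
  open PrimeFactorisation
  module F = RadicalHomogeneous homF
  module G = RadicalHomogeneous homG
  fact = factorise n
  on-products : ∀ ps → All Prime ps → F (product ps) ≡ G (product ps)
  on-products []       []         = trans F.at-1 (sym G.at-1)
  on-products (p ∷ ps) (pr ∷ prs) with p ∣? product ps
  ... | yes p∣n = begin
    F (p * n′)                   ≡⟨ F.*-∣ p n′ p∣n ⟩
    fromℕ (p ^ j) ℚ.* F n′       ≡⟨ cong (fromℕ (p ^ j) ℚ.*_) (on-products ps prs) ⟩
    fromℕ (p ^ j) ℚ.* G n′       ≡⟨ G.*-∣ p n′ p∣n ⟨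
    G (p * n′)                   ∎
    where
    n′ = product ps
    instance _ = productOfPrimes≢0 prs
             _ = prime⇒nonZero pr
  ... | no  p∤n = begin
    F (p * n′)                   ≡⟨ F.coprime-* p n′ coprime ⟩
    F p ℚ.* F n′                 ≡⟨ cong₂ ℚ._*_ (F≡G-on-primes p pr) (on-products ps prs) ⟩
    G p ℚ.* G n′                 ≡⟨ G.coprime-* p n′ coprime ⟨
    G (p * n′)                   ∎
    where
    n′ = product ps
    instance _ = productOfPrimes≢0 prs
             _ = prime⇒nonZero pr
    coprime : Coprime p n′
    coprime = Coprime.sym (∤⇒coprime-prime pr p∤n)

module _ (f : Poly) (c : ℤ) (j : ℕ) where
  open Counting f c
  open PrimeDivisorProduct (localFactor (suc j) f c)
    using ( ∏-primeDivisors; foldr-filter≡∏; ∏-primeDivisors-1; ∏-primeDivisors-prime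
          ; ∏-primeDivisors-coprime-*; ∏-primeDivisors-*-∣)

  productFormula≡∏-primeDivisors : ∀ n → productFormula (suc j) f c n ≡ fromℕ (n ^ j) ℚ.* ∏-primeDivisors n
  productFormula≡∏-primeDivisors n = cong (fromℕ (n ^ j) ℚ.*_) (foldr-filter≡∏ n (upTo (suc n)))

  productFormula-radicalHomogeneous : RadicalHomogeneous j (productFormula (suc j) f c)
  productFormula-radicalHomogeneous = record
    { at-1 = begin
        productFormula (suc j) f c 1   ≡⟨ productFormula≡∏-primeDivisors 1 ⟩
        fromℕ (1 ^ j) ℚ.* ∏-primeDivisors 1     ≡⟨ cong₂ ℚ._*_ (cong fromℕ (^-zeroˡ j)) ∏-primeDivisors-1 ⟩
        1ℚ ℚ.* 1ℚ                       ≡⟨ ℚP.*-identityˡ 1ℚ ⟩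
        1ℚ                              ∎
    ; coprime-* = λ m n cop → begin
        productFormula (suc j) f c (m * n)
          ≡⟨ productFormula≡∏-primeDivisors (m * n) ⟩
        fromℕ ((m * n) ^ j) ℚ.* ∏-primeDivisors (m * n)
          ≡⟨ cong₂ ℚ._*_ (trans (cong fromℕ (^-distribʳ-* m n j)) (fromℕ-* (m ^ j) (n ^ j)))
                         (∏-primeDivisors-coprime-* m n cop) ⟩
        (fromℕ (m ^ j) ℚ.* fromℕ (n ^ j)) ℚ.* (∏-primeDivisors m ℚ.* ∏-primeDivisors n)
          ≡⟨ ℚ-*-interchange (fromℕ (m ^ j)) (fromℕ (n ^ j)) (∏-primeDivisors m) (∏-primeDivisors n) ⟩
        (fromℕ (m ^ j) ℚ.* ∏-primeDivisors m) ℚ.* (fromℕ (n ^ j) ℚ.* ∏-primeDivisors n)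
          ≡⟨ cong₂ ℚ._*_ (productFormula≡∏-primeDivisors m) (productFormula≡∏-primeDivisors n) ⟨
        productFormula (suc j) f c m ℚ.* productFormula (suc j) f c n ∎
    ; *-∣ = λ d n d∣n → begin
        productFormula (suc j) f c (d * n)
          ≡⟨ productFormula≡∏-primeDivisors (d * n) ⟩
        fromℕ ((d * n) ^ j) ℚ.* ∏-primeDivisors (d * n)
          ≡⟨ cong₂ ℚ._*_ (trans (cong fromℕ (^-distribʳ-* d n j)) (fromℕ-* (d ^ j) (n ^ j)))
                         (∏-primeDivisors-*-∣ d n d∣n) ⟩
        (fromℕ (d ^ j) ℚ.* fromℕ (n ^ j)) ℚ.* ∏-primeDivisors n
          ≡⟨ ℚP.*-assoc (fromℕ (d ^ j)) (fromℕ (n ^ j)) (∏-primeDivisors n) ⟩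
        fromℕ (d ^ j) ℚ.* (fromℕ (n ^ j) ℚ.* ∏-primeDivisors n)
          ≡⟨ cong (fromℕ (d ^ j) ℚ.*_) (productFormula≡∏-primeDivisors n) ⟨
        fromℕ (d ^ j) ℚ.* productFormula (suc j) f c n ∎
    }

  𝒩-radicalHomogeneous : RadicalHomogeneous j (fromℕ ∘ 𝒩 (suc j) f c)
  𝒩-radicalHomogeneous = record
    { at-1      = cong fromℕ (𝒩-1 j)
    ; coprime-* = λ m n cop → trans (cong fromℕ (𝒩-coprime-* j m n cop)) (fromℕ-* (𝒩 (suc j) f c m) (𝒩 (suc j) f c n))
    ; *-∣       = λ d n d∣n → trans (cong fromℕ (𝒩-*-∣ j d n d∣n)) (fromℕ-* (d ^ j) (𝒩 (suc j) f c n))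
    }

  𝒩≡productFormula-prime : ∀ p → Prime p → fromℕ (𝒩 (suc j) f c p) ≡ productFormula (suc j) f c p
  𝒩≡productFormula-prime p@(suc _) pr = begin
    fromℕ (𝒩 (suc j) f c p)
      ≡⟨ fromℕ-complement (𝒩 (suc j) f c p) (𝓜 (suc j) f c p) (p ^ j) {{m^n≢0 p j}} (𝒩+𝓜≡p^j j p pr) ⟩
    fromℕ (p ^ j) ℚ.* localFactor (suc j) f c p
      ≡⟨ cong (fromℕ (p ^ j) ℚ.*_) (∏-primeDivisors-prime pr) ⟨
    fromℕ (p ^ j) ℚ.* ∏-primeDivisors p
      ≡⟨ productFormula≡∏-primeDivisors p ⟨
    productFormula (suc j) f c p ∎

theorem1p1 : (k : ℕ) → 2 ≤ k → (f : Poly) → NonConstant f → (c : ℤ) →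
  ((𝒩 k f c 1 ≡ 1)
   × (∀ m n → 1 ≤ m → 1 ≤ n → Coprime m n →
        𝒩 k f c (m * n) ≡ 𝒩 k f c m * 𝒩 k f c n))
  × (∀ n → 1 ≤ n → (+ 𝒩 k f c n) / 1 ≡ productFormula k f c n)
theorem1p1 zero ()
theorem1p1 (suc j) _ f _ c =
    (Counting.𝒩-1 f c j , λ m n 1≤m 1≤n → Counting.𝒩-coprime-* f c j m n {{>-nonZero 1≤m}} {{>-nonZero 1≤n}})
  , λ n 1≤n → determined-by-primes (𝒩-radicalHomogeneous f c j) (productFormula-radicalHomogeneous f c j)
                                   (𝒩≡productFormula-prime f c j) n {{>-nonZero 1≤n}}
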